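{- Let $p$ be a prime and $k \in \mathbb{N}$. Then: (1) $l_{p^{k+1}} = l_{p^k}$ if $p \mid c_{p^k}$, and $l_{p^{k+1}} = p\cdot l_{p^k}$ if $p \nmid c_{p^k}$. (2) If $p \nmid c_{p^k}$, then $p \nmid c_{p^{k+1}}$.
   Context: For a natural number $N$, $l_N$ denotes the length of the repeating cycle (minimal period) of the decimal expansion of $1/N$, with $l_N=1$ when $1/N$ terminates. $c_N$ denotes the repeating block of $1/N$ read as an integer: for $N$ coprime to $10$ (so $1/N$ is purely periodic), $c_N = \frac{10^{l_N}-1}{N}$; when $1/N$ is a terminating decimal, $c_N = 0$. $\mathbb{N}$ denotes the positive integers. -}

module Defs where

open import Data.Nat using (ℕ; zero; suc; _+_; _*_; _∸_; _^_; _≤_; _<_)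
open import Data.Nat.DivMod using (_/_; _%_)
open import Data.Nat.GCD using (gcd)
open import Data.Nat.Properties using (_≟_)
open import Data.Product using (_×_; ∃-syntax)
open import Relation.Nullary using (yes; no)
open import Relation.Binary.PropositionalEquality using (_≡_)

-- i-th digit after the decimal point of 1/N (for i ≥ 1):  ⌊10^i / N⌋ mod 10.
-- (For N = 0 we return 0; never used.)
digit : ℕ → ℕ → ℕ
digit zero    i = 0
digit (suc n) i = (10 ^ i / suc n) % 10

IsPeriod : ℕ → ℕ → Set
IsPeriod N l = 1 ≤ l × ∃[ M ] (∀ i → M ≤ i → digit N (i + l) ≡ digit N i)

-- l is the length of the repeating cycle (minimal period) of 1/N.
-- (A terminating expansion is eventually 000..., whose minimal period is 1.)
IsCycleLength : ℕ → ℕ → Set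
IsCycleLength N l = IsPeriod N l × (∀ l′ → IsPeriod N l′ → l ≤ l′)

-- c_N given the cycle length l = l_N:
-- (10^l - 1)/N when N is coprime to 10, and 0 otherwise
-- (for N = p^k with k ≥ 1 and p prime, "not coprime to 10" is exactly
--  the terminating case p ∈ {2,5}).
cBlock : ℕ → ℕ → ℕ
cBlock zero    l = 0
cBlock (suc n) l with gcd (suc n) 10 ≟ 1
... | yes _ = (10 ^ l ∸ 1) / suc n
... | no  _ = 0

{-# OPTIONS --safe #-}
module Submission where

-- For N coprime to 10, the digits of 1/N repeat with period l exactly when
-- N ∣ 10^l − 1: the remainders 10^i mod N drive the long division of 1 by N, and two
-- long divisions by N emitting the same digits from remainders below N start from the
-- same remainder, as otherwise their difference would grow like 10^j. Hence l_N is
-- the multiplicative order of 10 modulo N, and 10^(l_N) = 1 + c_N N.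
-- For an odd prime p and k ≥ 1, 10^l = 1 + c p^k gives 10^(pl) = 1 + (c + pW) p^(k+1)
-- by the binomial theorem, since p divides (p choose 2). So l_{p^k} ∣ l_{p^(k+1)} ∣ p l_{p^k};
-- the two lengths agree iff p^(k+1) ∣ c p^k, i.e. iff p ∣ c, and otherwise the new
-- block is c + pW, again prime to p. For p ∈ {2, 5} both expansions terminate: both
-- lengths are 1 and c = 0.

open import Defs
open import Data.Empty using (⊥-elim)
open import Data.Nat
open import Data.Nat.Combinatorics using (_C_; nC1≡n; nCk+nC[k+1]≡[n+1]C[k+1])
open import Data.Nat.Coprimality as Coprime
  using (Coprime; coprime-divisor; coprime⇒gcd≡1; gcd≡1⇒coprime)
open import Data.Nat.DivMod
open import Data.Nat.Divisibility
open import Data.Nat.GCD using (gcd)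
open import Data.Nat.Primality
  using (Prime; euclidsLemma; prime⇒irreducible; prime⇒nonZero; prime⇒nonTrivial)
open import Data.Nat.Properties
open import Data.Nat.Tactic.RingSolver using (solve-∀)
open import Data.Product using (_×_; _,_; proj₁; proj₂; ∃-syntax)
open import Data.Sum as Sum using (_⊎_; inj₁; inj₂)
open import Function using (_∘_; id)
open import Relation.Binary.Definitions using (tri<; tri≈; tri>)
open import Relation.Binary.PropositionalEquality
open import Relation.Nullary using (¬_; yes; no; contradiction)

private
  variable
    c k l l₁ l₂ m n N p : ℕ
    a b d e : ℕ → ℕ

nines : ℕ → ℕ
nines m = 10 ^ m ∸ 1

10^≡1+nines : ∀ m → 10 ^ m ≡ 1 + nines m
10^≡1+nines m = sym (m+[n∸m]≡n (m^n>0 10 m))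

10^[m+n]≡10^m+10^m*nines[n] : ∀ m n → 10 ^ (m + n) ≡ 10 ^ m + 10 ^ m * nines n
10^[m+n]≡10^m+10^m*nines[n] m n = begin
  10 ^ (m + n)                  ≡⟨ ^-distribˡ-+-* 10 m n ⟩
  10 ^ m * 10 ^ n               ≡⟨ cong (10 ^ m *_) (10^≡1+nines n) ⟩
  10 ^ m * (1 + nines n)        ≡⟨ *-distribˡ-+ (10 ^ m) 1 (nines n) ⟩
  10 ^ m * 1 + 10 ^ m * nines n ≡⟨ cong (_+ 10 ^ m * nines n) (*-identityʳ (10 ^ m)) ⟩
  10 ^ m + 10 ^ m * nines n     ∎
  where open ≡-Reasoning

nines-+ : ∀ m n → nines (m + n) ≡ nines m + 10 ^ m * nines n
nines-+ m n = suc-injective (begin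
  1 + nines (m + n)              ≡⟨ 10^≡1+nines (m + n) ⟨
  10 ^ (m + n)                   ≡⟨ 10^[m+n]≡10^m+10^m*nines[n] m n ⟩
  10 ^ m + 10 ^ m * nines n      ≡⟨ cong (_+ 10 ^ m * nines n) (10^≡1+nines m) ⟩
  1 + nines m + 10 ^ m * nines n ∎)
  where open ≡-Reasoning

n<10^n : ∀ n → n < 10 ^ n
n<10^n zero    = s≤s z≤n
n<10^n (suc n) = begin-strict
  suc n           <⟨ s≤s (n<10^n n) ⟩
  1 + 10 ^ n      ≡⟨ +-comm 1 (10 ^ n) ⟩
  10 ^ n + 1      ≤⟨ +-monoʳ-≤ (10 ^ n) (m^n>0 10 n) ⟩
  10 ^ n + 10 ^ n ≤⟨ +-monoʳ-≤ (10 ^ n) (m≤n*m (10 ^ n) 9) ⟩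
  10 ^ suc n      ∎
  where open ≤-Reasoning

^-monoˡ-∣ : ∀ k → m ∣ n → m ^ k ∣ n ^ k
^-monoˡ-∣ zero    _   = ∣-refl
^-monoˡ-∣ (suc k) m∣n = *-pres-∣ m∣n (^-monoˡ-∣ k m∣n)

^-monoʳ-∣ : ∀ m → k ≤ n → m ^ k ∣ m ^ n
^-monoʳ-∣ {k} m k≤n with o , refl ← m≤n⇒∃[o]m+o≡n k≤n =
  subst (m ^ k ∣_) (sym (^-distribˡ-+-* m k o)) (m∣m*n (m ^ o))

coprime-*ʳ : Coprime m n → Coprime m k → Coprime m (n * k)
coprime-*ʳ m⊥n m⊥k (d∣m , d∣nk) =
  m⊥k (d∣m , coprime-divisor (λ (e∣d , e∣n) → m⊥n (∣-trans e∣d d∣m , e∣n)) d∣nk)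

coprime-^ʳ : Coprime m n → ∀ k → Coprime m (n ^ k)
coprime-^ʳ m⊥n zero    (_ , d∣1) = ∣1⇒≡1 d∣1
coprime-^ʳ m⊥n (suc k)           = coprime-*ʳ m⊥n (coprime-^ʳ m⊥n k)

coprime-^ˡ : Coprime m n → ∀ k → Coprime (m ^ k) n
coprime-^ˡ m⊥n k = Coprime.sym (coprime-^ʳ (Coprime.sym m⊥n) k)

prime∤⇒coprime : Prime p → ¬ p ∣ n → Coprime p n
prime∤⇒coprime pp p∤n (d∣p , d∣n) with prime⇒irreducible pp d∣p
... | inj₁ d≡1  = d≡1
... | inj₂ refl = contradiction d∣n p∤n

∤10⇒∤2 : ¬ p ∣ 10 → ¬ p ∣ 2
∤10⇒∤2 p∤10 p∣2 = p∤10 (∣-trans p∣2 (divides 5 refl))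

m∣n∣p*m⇒n≡m⊎n≡p*m : Prime p → 1 ≤ m → m ∣ n → n ∣ p * m → n ≡ m ⊎ n ≡ p * m
m∣n∣p*m⇒n≡m⊎n≡p*m {p} {m} pp m≥1 (divides t refl) t*m∣p*m
  with prime⇒irreducible pp t∣p
  where
  t∣p : t ∣ p
  t∣p = *-cancelʳ-∣ m {{>-nonZero m≥1}} t*m∣p*m
... | inj₁ refl = inj₁ (*-identityˡ m)
... | inj₂ refl = inj₂ refl

[m+n]%d≡m%d⇒d∣n : ∀ d .{{_ : NonZero d}} m n → (m + n) % d ≡ m % d → d ∣ n
[m+n]%d≡m%d⇒d∣n d m n eq = ∣m+n∣m⇒∣n d∣m/d*d+n (n∣m*n (m / d))
  where
  open ≡-Reasoning
  d∣m/d*d+n : d ∣ m / d * d + n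
  d∣m/d*d+n = divides ((m + n) / d) (+-cancelˡ-≡ (m % d) _ _ (begin
    m % d + (m / d * d + n)       ≡⟨ +-assoc (m % d) (m / d * d) n ⟨
    m % d + m / d * d + n         ≡⟨ cong (_+ n) (m≡m%n+[m/n]*n m d) ⟨
    m + n                         ≡⟨ m≡m%n+[m/n]*n (m + n) d ⟩
    (m + n) % d + (m + n) / d * d ≡⟨ cong (_+ (m + n) / d * d) eq ⟩
    m % d + (m + n) / d * d       ∎))

∣nines-+ : ∀ m n → N ∣ nines m → N ∣ nines n → N ∣ nines (m + n)
∣nines-+ {N} m n N∣m N∣n =
  subst (N ∣_) (sym (nines-+ m n)) (∣m∣n⇒∣m+n N∣m (∣n⇒∣m*n (10 ^ m) N∣n))

∣nines-* : ∀ l → N ∣ nines l → ∀ q → N ∣ nines (q * l)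
∣nines-* {N} l N∣l zero    = N ∣0
∣nines-* {N} l N∣l (suc q) = ∣nines-+ l (q * l) N∣l (∣nines-* l N∣l q)

∣nines-+⇒∣nines : ∀ m n → Coprime N 10 → N ∣ nines (m + n) → N ∣ nines m → N ∣ nines n
∣nines-+⇒∣nines {N} m n N⊥10 N∣m+n N∣m = coprime-divisor (coprime-^ʳ N⊥10 m)
  (∣m+n∣m⇒∣n (subst (N ∣_) (nines-+ m n) N∣m+n) N∣m)

IsOrderOfTen : ℕ → ℕ → Set
IsOrderOfTen N l = 1 ≤ l × N ∣ nines l × (∀ m → 1 ≤ m → N ∣ nines m → l ≤ m)

isOrderOfTen⇒∣ : Coprime N 10 → IsOrderOfTen N l → N ∣ nines m → l ∣ m
isOrderOfTen⇒∣ {N} {l} {m} N⊥10 (l≥1 , N∣l , least) N∣m =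
  m%n≡0⇒n∣m m l (below-order (m % l) (m%n<n m l) N∣m%l)
  where
  instance
    l≢0 : NonZero l
    l≢0 = >-nonZero l≥1
  N∣m%l : N ∣ nines (m % l)
  N∣m%l = ∣nines-+⇒∣nines (m / l * l) (m % l) N⊥10
    (subst (N ∣_ ) (cong nines (trans (m≡m%n+[m/n]*n m l) (+-comm (m % l) _))) N∣m)
    (∣nines-* l N∣l (m / l))
  below-order : ∀ r → r < l → N ∣ nines r → r ≡ 0
  below-order zero    _   _   = refl
  below-order (suc r) r<l N∣r = contradiction (least (suc r) (s≤s z≤n) N∣r) (<⇒≱ r<l)

IsLongDivision : ℕ → (ℕ → ℕ) → (ℕ → ℕ) → Set
IsLongDivision N d r = ∀ j → r j < N × r (suc j) + N * d j ≡ 10 * r j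

longDivision-cong : (∀ j → d j ≡ e j) → IsLongDivision N d a → IsLongDivision N e a
longDivision-cong {N = N} {a = a} d≡e A j =
  proj₁ (A j) , subst (λ x → a (suc j) + N * x ≡ 10 * a j) (d≡e j) (proj₂ (A j))

longDivision-gap : IsLongDivision N d a → IsLongDivision N d b →
                   ∀ x → b 0 ≡ a 0 + x → ∀ j → b j ≡ a j + 10 ^ j * x
longDivision-gap {a = a} A B x b₀≡a₀+x zero =
  trans b₀≡a₀+x (cong (a 0 +_) (sym (*-identityˡ x)))
longDivision-gap {N} {d} {a} {b} A B x b₀≡a₀+x (suc j) = +-cancelʳ-≡ (N * d j) _ _ (begin
  b (suc j) + N * d j                  ≡⟨ proj₂ (B j) ⟩
  10 * b j                             ≡⟨ cong (10 *_) (longDivision-gap A B x b₀≡a₀+x j) ⟩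
  10 * (a j + 10 ^ j * x)              ≡⟨ distrib (a j) (10 ^ j) x ⟩
  10 * a j + 10 ^ suc j * x            ≡⟨ cong (_+ 10 ^ suc j * x) (proj₂ (A j)) ⟨
  a (suc j) + N * d j + 10 ^ suc j * x ≡⟨ +-swap (a (suc j)) (N * d j) (10 ^ suc j * x) ⟩
  a (suc j) + 10 ^ suc j * x + N * d j ∎)
  where
  open ≡-Reasoning
  distrib : ∀ a t x → 10 * (a + t * x) ≡ 10 * a + 10 * t * x
  distrib = solve-∀
  +-swap : ∀ u v w → u + v + w ≡ u + w + v
  +-swap = solve-∀

longDivision-¬< : IsLongDivision N d a → IsLongDivision N d b → ¬ a 0 < b 0
longDivision-¬< {N} {a = a} {b} A B a₀<b₀ = <⇒≱ (proj₁ (B N)) (begin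
  N                          ≤⟨ <⇒≤ (n<10^n N) ⟩
  10 ^ N                     ≡⟨ *-identityʳ (10 ^ N) ⟨
  10 ^ N * 1                 ≤⟨ *-monoʳ-≤ (10 ^ N) (m<n⇒0<n∸m a₀<b₀) ⟩
  10 ^ N * (b 0 ∸ a 0)       ≤⟨ m≤n+m _ (a N) ⟩
  a N + 10 ^ N * (b 0 ∸ a 0) ≡⟨ longDivision-gap A B (b 0 ∸ a 0) b₀≡a₀+[b₀∸a₀] N ⟨
  b N                        ∎)
  where
  open ≤-Reasoning
  b₀≡a₀+[b₀∸a₀] : b 0 ≡ a 0 + (b 0 ∸ a 0)
  b₀≡a₀+[b₀∸a₀] = sym (m+[n∸m]≡n (<⇒≤ a₀<b₀))

longDivision-unique : IsLongDivision N d a → IsLongDivision N d b → a 0 ≡ b 0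
longDivision-unique {a = a} {b = b} A B with <-cmp (a 0) (b 0)
... | tri< a₀<b₀ _ _ = contradiction a₀<b₀ (longDivision-¬< A B)
... | tri≈ _ a₀≡b₀ _ = a₀≡b₀
... | tri> _ _ b₀<a₀ = contradiction b₀<a₀ (longDivision-¬< B A)

digit-step : ∀ N .{{_ : NonZero N}} i →
             10 ^ suc i % N + N * digit N (suc i) ≡ 10 * (10 ^ i % N)
digit-step N@(suc _) i = +-cancelʳ-≡ (10 * (q * N)) _ _ (begin
  r′ + N * δ + 10 * (q * N) ≡⟨ regroup r′ N δ q ⟩
  r′ + (δ + q * 10) * N     ≡⟨ cong (λ x → r′ + x * N) q′≡δ+q*10 ⟨
  r′ + q′ * N               ≡⟨ m≡m%n+[m/n]*n (10 ^ suc i) N ⟨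
  10 * 10 ^ i               ≡⟨ cong (10 *_) (m≡m%n+[m/n]*n (10 ^ i) N) ⟩
  10 * (r + q * N)          ≡⟨ *-distribˡ-+ 10 r (q * N) ⟩
  10 * r + 10 * (q * N)     ∎)
  where
  open ≡-Reasoning
  r q r′ q′ δ : ℕ
  r  = 10 ^ i % N
  q  = 10 ^ i / N
  r′ = 10 ^ suc i % N
  q′ = 10 ^ suc i / N
  δ  = digit N (suc i)
  q′/10≡q : q′ / 10 ≡ q
  q′/10≡q = begin
    10 ^ suc i / N / 10    ≡⟨ m/n/o≡m/[n*o] (10 ^ suc i) N 10 ⟩
    10 ^ suc i / (N * 10)  ≡⟨ /-congˡ {o = N * 10} (*-comm 10 (10 ^ i)) ⟩
    10 ^ i * 10 / (N * 10) ≡⟨ m*n/o*n≡m/o (10 ^ i) 10 N ⟩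
    q                      ∎
  q′≡δ+q*10 : q′ ≡ δ + q * 10
  q′≡δ+q*10 = trans (m≡m%n+[m/n]*n q′ 10) (cong (λ x → δ + x * 10) q′/10≡q)
  regroup : ∀ r N d q → r + N * d + 10 * (q * N) ≡ r + (d + q * 10) * N
  regroup = solve-∀

powersOfTen-longDivision : ∀ N .{{_ : NonZero N}} M →
  IsLongDivision N (λ j → digit N (suc (j + M))) (λ j → 10 ^ (j + M) % N)
powersOfTen-longDivision N M j = m%n<n (10 ^ (j + M)) N , digit-step N (j + M)

digit-shift : ∀ N .{{_ : NonZero N}} l i → N ∣ nines l → digit N (suc i + l) ≡ digit N (suc i)
digit-shift N@(suc _) l i N∣l = begin
  10 ^ (suc i + l) / N % 10
    ≡⟨ cong (λ x → x / N % 10) (10^[m+n]≡10^m+10^m*nines[n] (suc i) l) ⟩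
  (10 ^ suc i + 10 ^ suc i * nines l) / N % 10
    ≡⟨ cong (_% 10) (+-distrib-/-∣ʳ (10 ^ suc i) (∣n⇒∣m*n (10 ^ suc i) N∣l)) ⟩
  (10 ^ suc i / N + 10 ^ suc i * nines l / N) % 10
    ≡⟨ %-remove-+ʳ (10 ^ suc i / N) 10∣shift ⟩
  10 ^ suc i / N % 10 ∎
  where
  open ≡-Reasoning
  10∣shift : 10 ∣ 10 ^ suc i * nines l / N
  10∣shift = subst (10 ∣_) (sym (*-/-assoc (10 ^ suc i) N∣l))
                   (∣m⇒∣m*n (nines l / N) (m∣m*n (10 ^ i)))

∣nines⇒isPeriod : ∀ N .{{_ : NonZero N}} l → 1 ≤ l → N ∣ nines l → IsPeriod N l
∣nines⇒isPeriod N l l≥1 N∣l = l≥1 , 1 , λ { (suc i) _ → digit-shift N l i N∣l }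

isPeriod⇒∣nines : ∀ N .{{_ : NonZero N}} l → Coprime N 10 → IsPeriod N l → N ∣ nines l
isPeriod⇒∣nines N l N⊥10 (_ , M , periodic) =
  coprime-divisor (coprime-^ʳ N⊥10 M) ([m+n]%d≡m%d⇒d∣n N (10 ^ M) _ same-remainder)
  where
  shifted-digits : ∀ j → digit N (suc (j + (M + l))) ≡ digit N (suc (j + M))
  shifted-digits j = trans (cong (λ x → digit N (suc x)) (sym (+-assoc j M l)))
                           (periodic (suc (j + M)) (≤-trans (m≤n+m M j) (n≤1+n _)))
  same-remainder : (10 ^ M + 10 ^ M * nines l) % N ≡ 10 ^ M % N
  same-remainder = trans (cong (_% N) (sym (10^[m+n]≡10^m+10^m*nines[n] M l)))
    (longDivision-unique
      (longDivision-cong shifted-digits (powersOfTen-longDivision N (M + l)))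
      (powersOfTen-longDivision N M))

isCycleLength⇒isOrderOfTen : ∀ N .{{_ : NonZero N}} l →
                             Coprime N 10 → IsCycleLength N l → IsOrderOfTen N l
isCycleLength⇒isOrderOfTen N l N⊥10 (period , minimal) =
  proj₁ period , isPeriod⇒∣nines N l N⊥10 period ,
  λ m m≥1 N∣m → minimal m (∣nines⇒isPeriod N m m≥1 N∣m)

digit-eventually-0 : ∀ N .{{_ : NonZero N}} K i → N ∣ 10 ^ K → K ≤ i → digit N (suc i) ≡ 0
digit-eventually-0 N@(suc _) K i N∣10^K K≤i = begin
  10 * 10 ^ i / N % 10   ≡⟨ cong (_% 10) (*-/-assoc 10 N∣10^i) ⟩
  10 * (10 ^ i / N) % 10 ≡⟨ cong (_% 10) (*-comm 10 (10 ^ i / N)) ⟩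
  10 ^ i / N * 10 % 10   ≡⟨ m*n%n≡0 (10 ^ i / N) 10 ⟩
  0                      ∎
  where
  open ≡-Reasoning
  N∣10^i : N ∣ 10 ^ i
  N∣10^i = ∣-trans N∣10^K (^-monoʳ-∣ 10 K≤i)

∣10^⇒cycleLength≡1 : ∀ N .{{_ : NonZero N}} K l → N ∣ 10 ^ K → IsCycleLength N l → l ≡ 1
∣10^⇒cycleLength≡1 N K l N∣10^K ((l≥1 , _) , minimal) =
  ≤-antisym (minimal 1 (≤-refl , suc K , eventually-constant)) l≥1
  where
  eventually-constant : ∀ i → suc K ≤ i → digit N (i + 1) ≡ digit N i
  eventually-constant (suc i) (s≤s K≤i) =
    trans (digit-eventually-0 N K (i + 1) N∣10^K (≤-trans K≤i (m≤m+n i 1)))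
          (sym (digit-eventually-0 N K i N∣10^K K≤i))

cBlock*N≡nines : ∀ N .{{_ : NonZero N}} l → Coprime N 10 → N ∣ nines l → cBlock N l * N ≡ nines l
cBlock*N≡nines (suc n) l N⊥10 N∣l with gcd (suc n) 10 ≟ 1
... | yes _    = m/n*n≡m N∣l
... | no gcd≢1 = contradiction (coprime⇒gcd≡1 N⊥10) gcd≢1

cBlock≡0 : ∀ N l → ¬ Coprime N 10 → cBlock N l ≡ 0
cBlock≡0 zero    l _     = refl
cBlock≡0 (suc n) l N⊥̸10 with gcd (suc n) 10 ≟ 1
... | yes gcd≡1 = ⊥-elim (N⊥̸10 (gcd≡1⇒coprime gcd≡1))
... | no _      = refl

[1+n]C2≡n+nC2 : ∀ n → suc n C 2 ≡ n + n C 2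
[1+n]C2≡n+nC2 n = trans (sym (nCk+nC[k+1]≡[n+1]C[k+1] n 1)) (cong (_+ n C 2) (nC1≡n n))

2*nC2≡n*[n∸1] : ∀ n → 2 * (n C 2) ≡ n * (n ∸ 1)
2*nC2≡n*[n∸1] zero          = refl
2*nC2≡n*[n∸1] (suc zero)    = refl
2*nC2≡n*[n∸1] (suc (suc n)) = begin
  2 * (suc (suc n) C 2)       ≡⟨ cong (2 *_) ([1+n]C2≡n+nC2 (suc n)) ⟩
  2 * (suc n + suc n C 2)     ≡⟨ *-distribˡ-+ 2 (suc n) (suc n C 2) ⟩
  2 * suc n + 2 * (suc n C 2) ≡⟨ cong (2 * suc n +_) (2*nC2≡n*[n∸1] (suc n)) ⟩
  2 * suc n + suc n * n       ≡⟨ collect n ⟩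
  suc (suc n) * suc n         ∎
  where
  open ≡-Reasoning
  collect : ∀ n → 2 * suc n + suc n * n ≡ suc (suc n) * suc n
  collect = solve-∀

prime∣pC2 : Prime p → ¬ p ∣ 2 → p ∣ p C 2
prime∣pC2 {p} pp p∤2 with euclidsLemma 2 (p C 2) pp p∣2*pC2
  where
  p∣2*pC2 : p ∣ 2 * (p C 2)
  p∣2*pC2 = divides (p ∸ 1) (trans (2*nC2≡n*[n∸1] p) (*-comm p (p ∸ 1)))
... | inj₁ p∣2   = contradiction p∣2 p∤2
... | inj₂ p∣pC2 = p∣pC2

binomial-three-terms : ∀ y n →
  ∃[ U ] (1 + y) ^ n ≡ 1 + n * y + (n C 2) * (y * y) + U * (y * y * y)
binomial-three-terms y zero = 0 , refl
binomial-three-terms y (suc n) with U , eq ← binomial-three-terms y n =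
  U + n C 2 + U * y , (begin
  (1 + y) * (1 + y) ^ n
    ≡⟨ cong ((1 + y) *_) eq ⟩
  (1 + y) * (1 + n * y + (n C 2) * (y * y) + U * (y * y * y))
    ≡⟨ expand y n (n C 2) U ⟩
  1 + suc n * y + (n + n C 2) * (y * y) + U′ * (y * y * y)
    ≡⟨ cong (λ b → 1 + suc n * y + b * (y * y) + U′ * (y * y * y)) ([1+n]C2≡n+nC2 n) ⟨
  1 + suc n * y + (suc n C 2) * (y * y) + U′ * (y * y * y) ∎)
  where
  open ≡-Reasoning
  U′ : ℕ
  U′ = U + n C 2 + U * y
  expand : ∀ y n b U → (1 + y) * (1 + n * y + b * (y * y) + U * (y * y * y))
                       ≡ 1 + suc n * y + (n + b) * (y * y) + (U + b + U * y) * (y * y * y)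
  expand = solve-∀

[1+c*p^[1+k]]^p≡1+[c+p*W]*p^[2+k] : Prime p → ¬ p ∣ 2 → ∀ c k →
  ∃[ W ] (1 + c * p ^ suc k) ^ p ≡ 1 + (c + p * W) * p ^ suc (suc k)
[1+c*p^[1+k]]^p≡1+[c+p*W]*p^[2+k] {p} pp p∤2 c k
  with divides b pC2≡b*p ← prime∣pC2 pp p∤2
     | U , expansion ← binomial-three-terms (c * p ^ suc k) p
  = b * c * c * P + U * c * c * c * P * P , (begin
  (1 + y) ^ p
    ≡⟨ expansion ⟩
  1 + p * y + (p C 2) * (y * y) + U * (y * y * y)
    ≡⟨ cong (λ x → 1 + p * y + x * (y * y) + U * (y * y * y)) pC2≡b*p ⟩
  1 + p * y + b * p * (y * y) + U * (y * y * y)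
    ≡⟨ collect p P c b U ⟩
  1 + (c + p * (b * c * c * P + U * c * c * c * P * P)) * (p * (p * P)) ∎)
  where
  open ≡-Reasoning
  P y : ℕ
  P = p ^ k
  y = c * p ^ suc k
  collect : ∀ p P c b U →
    1 + p * (c * (p * P)) + b * p * ((c * (p * P)) * (c * (p * P)))
      + U * ((c * (p * P)) * (c * (p * P)) * (c * (p * P)))
    ≡ 1 + (c + p * (b * c * c * P + U * c * c * c * P * P)) * (p * (p * P))
  collect = solve-∀

nines[p*l]≡[c+p*W]*p^[2+k] : Prime p → ¬ p ∣ 2 → nines l ≡ c * p ^ suc k →
  ∃[ W ] nines (p * l) ≡ (c + p * W) * p ^ suc (suc k)
nines[p*l]≡[c+p*W]*p^[2+k] {p} {l} {c} {k} pp p∤2 nines[l]≡c*p^[1+k]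
  with W , lifted ← [1+c*p^[1+k]]^p≡1+[c+p*W]*p^[2+k] pp p∤2 c k
  = W , cong (_∸ 1) (begin
  10 ^ (p * l)                      ≡⟨ cong (10 ^_) (*-comm p l) ⟩
  10 ^ (l * p)                      ≡⟨ ^-*-assoc 10 l p ⟨
  (10 ^ l) ^ p                      ≡⟨ cong (_^ p) 10^l≡1+c*p^[1+k] ⟩
  (1 + c * p ^ suc k) ^ p           ≡⟨ lifted ⟩
  1 + (c + p * W) * p ^ suc (suc k) ∎)
  where
  open ≡-Reasoning
  10^l≡1+c*p^[1+k] : 10 ^ l ≡ 1 + c * p ^ suc k
  10^l≡1+c*p^[1+k] = trans (10^≡1+nines l) (cong (1 +_) nines[l]≡c*p^[1+k])

isOrderOfTen-lift : Prime p → ¬ p ∣ 10 → nines l₁ ≡ c * p ^ suc k →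
  IsOrderOfTen (p ^ suc k) l₁ → IsOrderOfTen (p ^ suc (suc k)) l₂ →
  (p ∣ c → l₂ ≡ l₁) × (¬ p ∣ c → l₂ ≡ p * l₁)
isOrderOfTen-lift {p} {l₁} {c} {k} {l₂} pp p∤10 nines[l₁]≡c*N₁
                  ord₁@(l₁≥1 , _) ord₂@(_ , N₂∣nines[l₂] , _) =
  p∣c⇒l₂≡l₁ , p∤c⇒l₂≡p*l₁
  where
  N₁ N₂ : ℕ
  N₁ = p ^ suc k
  N₂ = p ^ suc (suc k)
  instance
    p≢0 : NonZero p
    p≢0 = prime⇒nonZero pp
    N₁≢0 : NonZero N₁
    N₁≢0 = m^n≢0 p (suc k)
  N₂⊥10 : Coprime N₂ 10
  N₂⊥10 = coprime-^ˡ (prime∤⇒coprime pp p∤10) (suc (suc k))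
  l₁∣l₂ : l₁ ∣ l₂
  l₁∣l₂ = isOrderOfTen⇒∣ (coprime-^ˡ (prime∤⇒coprime pp p∤10) (suc k)) ord₁
                         (∣-trans (n∣m*n p) N₂∣nines[l₂])
  l₂∣p*l₁ : l₂ ∣ p * l₁
  l₂∣p*l₁ with W , nines[p*l₁]≡[c+p*W]*N₂
                ← nines[p*l]≡[c+p*W]*p^[2+k] {c = c} {k} pp (∤10⇒∤2 p∤10) nines[l₁]≡c*N₁
    = isOrderOfTen⇒∣ N₂⊥10 ord₂ (divides (c + p * W) nines[p*l₁]≡[c+p*W]*N₂)
  p∣c⇒N₂∣nines[l₁] : p ∣ c → N₂ ∣ nines l₁
  p∣c⇒N₂∣nines[l₁] p∣c = subst (N₂ ∣_) (sym nines[l₁]≡c*N₁) (*-pres-∣ p∣c ∣-refl)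
  N₂∣nines[l₁]⇒p∣c : N₂ ∣ nines l₁ → p ∣ c
  N₂∣nines[l₁]⇒p∣c N₂∣nines[l₁] = *-cancelʳ-∣ N₁ (subst (N₂ ∣_) nines[l₁]≡c*N₁ N₂∣nines[l₁])
  p∣c⇒l₂≡l₁ : p ∣ c → l₂ ≡ l₁
  p∣c⇒l₂≡l₁ p∣c = ∣-antisym (isOrderOfTen⇒∣ N₂⊥10 ord₂ (p∣c⇒N₂∣nines[l₁] p∣c)) l₁∣l₂
  p∤c⇒l₂≡p*l₁ : ¬ p ∣ c → l₂ ≡ p * l₁
  p∤c⇒l₂≡p*l₁ p∤c = Sum.[ ⊥-elim ∘ l₂≢l₁ , id ] (m∣n∣p*m⇒n≡m⊎n≡p*m pp l₁≥1 l₁∣l₂ l₂∣p*l₁)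
    where
    l₂≢l₁ : l₂ ≢ l₁
    l₂≢l₁ l₂≡l₁ = p∤c (N₂∣nines[l₁]⇒p∣c (subst (λ l → N₂ ∣ nines l) l₂≡l₁ N₂∣nines[l₂]))

p∤c⇒p∤cBlock[p*l] : Prime p → ¬ p ∣ 10 → nines l ≡ c * p ^ suc k → ¬ p ∣ c →
  ¬ p ∣ cBlock (p ^ suc (suc k)) (p * l)
p∤c⇒p∤cBlock[p*l] {p} {l} {c} {k} pp p∤10 nines[l]≡c*N₁ p∤c p∣cBlock
  with W , nines[p*l]≡[c+p*W]*N₂
         ← nines[p*l]≡[c+p*W]*p^[2+k] {c = c} {k} pp (∤10⇒∤2 p∤10) nines[l]≡c*N₁
  = p∤c (∣m+n∣m⇒∣n (subst (p ∣_) (+-comm c (p * W)) p∣c+p*W) (m∣m*n W))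
  where
  N₂ : ℕ
  N₂ = p ^ suc (suc k)
  instance
    p≢0 : NonZero p
    p≢0 = prime⇒nonZero pp
    N₂≢0 : NonZero N₂
    N₂≢0 = m^n≢0 p (suc (suc k))
  cBlock*N₂≡nines[p*l] : cBlock N₂ (p * l) * N₂ ≡ nines (p * l)
  cBlock*N₂≡nines[p*l] = cBlock*N≡nines N₂ (p * l)
    (coprime-^ˡ (prime∤⇒coprime pp p∤10) (suc (suc k)))
    (divides (c + p * W) nines[p*l]≡[c+p*W]*N₂)
  p∣c+p*W : p ∣ c + p * W
  p∣c+p*W = subst (p ∣_) (*-cancelʳ-≡ _ _ N₂ (trans cBlock*N₂≡nines[p*l] nines[p*l]≡[c+p*W]*N₂))
                  p∣cBlock

prime∣10⇒cycleLength≡1 : Prime p → p ∣ 10 → ∀ j → IsCycleLength (p ^ j) l → l ≡ 1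
prime∣10⇒cycleLength≡1 {p} {l} pp p∣10 j =
  ∣10^⇒cycleLength≡1 (p ^ j) {{m^n≢0 p j {{prime⇒nonZero pp}}}} j l (^-monoˡ-∣ j p∣10)

prime∣10⇒cBlock≡0 : Prime p → p ∣ 10 → ∀ k → cBlock (p ^ suc k) l ≡ 0
prime∣10⇒cBlock≡0 {p} {l} pp p∣10 k = cBlock≡0 (p ^ suc k) l p^[1+k]⊥̸10
  where
  p^[1+k]⊥̸10 : ¬ Coprime (p ^ suc k) 10
  p^[1+k]⊥̸10 p^[1+k]⊥10 =
    nonTrivial⇒≢1 {{prime⇒nonTrivial pp}} (p^[1+k]⊥10 (m∣m*n (p ^ k) , p∣10))

prime∤10⇒isOrderOfTen : Prime p → ¬ p ∣ 10 → ∀ j →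
                        IsCycleLength (p ^ j) l → IsOrderOfTen (p ^ j) l
prime∤10⇒isOrderOfTen {p} {l} pp p∤10 j =
  isCycleLength⇒isOrderOfTen (p ^ j) {{m^n≢0 p j {{prime⇒nonZero pp}}}} l
    (coprime-^ˡ (prime∤⇒coprime pp p∤10) j)

prime∤10⇒nines≡cBlock*p^j : Prime p → ¬ p ∣ 10 → ∀ j →
                            IsOrderOfTen (p ^ j) l → nines l ≡ cBlock (p ^ j) l * p ^ j
prime∤10⇒nines≡cBlock*p^j {p} {l} pp p∤10 j (_ , p^j∣nines[l] , _) =
  sym (cBlock*N≡nines (p ^ j) {{m^n≢0 p j {{prime⇒nonZero pp}}}} l
    (coprime-^ˡ (prime∤⇒coprime pp p∤10) j) p^j∣nines[l])

lemma3p4 : (p k : ℕ) → Prime p → 1 ≤ k →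
           (l₁ l₂ : ℕ) → IsCycleLength (p ^ k) l₁ → IsCycleLength (p ^ suc k) l₂ →
           ((p ∣ cBlock (p ^ k) l₁ → l₂ ≡ l₁)
             × (¬ (p ∣ cBlock (p ^ k) l₁) → l₂ ≡ p * l₁))
           × (¬ (p ∣ cBlock (p ^ k) l₁) → ¬ (p ∣ cBlock (p ^ suc k) l₂))
lemma3p4 p (suc k) pp _ l₁ l₂ cyc₁ cyc₂ with p ∣? 10
... | yes p∣10 = ((λ _ → l₂≡l₁) , contradiction p∣c₁) , contradiction p∣c₁
  where
  l₂≡l₁ : l₂ ≡ l₁
  l₂≡l₁ = trans (prime∣10⇒cycleLength≡1 pp p∣10 (2 + k) cyc₂)
                (sym (prime∣10⇒cycleLength≡1 pp p∣10 (1 + k) cyc₁))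
  p∣c₁ : p ∣ cBlock (p ^ suc k) l₁
  p∣c₁ = subst (p ∣_) (sym (prime∣10⇒cBlock≡0 pp p∣10 k)) (p ∣0)
... | no p∤10 = lengths , p∤c₁⇒p∤c₂
  where
  ord₁ : IsOrderOfTen (p ^ suc k) l₁
  ord₁ = prime∤10⇒isOrderOfTen pp p∤10 (1 + k) cyc₁
  nines[l₁]≡c₁*p^[1+k] : nines l₁ ≡ cBlock (p ^ suc k) l₁ * p ^ suc k
  nines[l₁]≡c₁*p^[1+k] = prime∤10⇒nines≡cBlock*p^j pp p∤10 (1 + k) ord₁
  lengths : (p ∣ cBlock (p ^ suc k) l₁ → l₂ ≡ l₁) × (¬ p ∣ cBlock (p ^ suc k) l₁ → l₂ ≡ p * l₁)
  lengths = isOrderOfTen-lift {k = k} pp p∤10 nines[l₁]≡c₁*p^[1+k] ord₁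
                              (prime∤10⇒isOrderOfTen pp p∤10 (2 + k) cyc₂)
  p∤c₁⇒p∤c₂ : ¬ p ∣ cBlock (p ^ suc k) l₁ → ¬ p ∣ cBlock (p ^ suc (suc k)) l₂
  p∤c₁⇒p∤c₂ p∤c₁ = subst (λ l → ¬ p ∣ cBlock (p ^ suc (suc k)) l) (sym (proj₂ lengths p∤c₁))
                         (p∤c⇒p∤cBlock[p*l] {k = k} pp p∤10 nines[l₁]≡c₁*p^[1+k] p∤c₁)
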